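{- Let $s\ge 2$ and $t\ge 0$ be integers. Let $C$ be a cycle in a connected graph $H$ and let $w$ be a vertex of $C$ of degree $2$ in $H$. If $G$ is the graph obtained from $H$ and a disjoint copy of the subdivided star $S_s(K_{1,s+t})$ by identifying $w$ with the center of $S_s(K_{1,s+t})$, then there exists a nontrivial connected graph $G'$ with $f(G')<f(G)$ such that $\gamma_2(G')\le a(G')+1$ implies $\gamma_2(G)\le a(G)+1$.
   Context: All graphs are finite, simple and undirected; $n(G)$, $m(G)$ denote the numbers of vertices and edges, and $n_1(G)$ the number of leaves (vertices of degree $1$). A graph is nontrivial if it has at least $2$ vertices. Define $f(G)=n(G)+3m(G)+n_1(G)$. For a graph $G$ with non-decreasing degree sequence $d_1\le\cdots\le d_n$, the annihilation number $a(G)$ is the largest integer $k$ such that $\sum_{i=1}^k d_i\le m(G)$. The $2$-domination number $\gamma_2(G)$ is the minimum cardinality of a set $S\subseteq V(G)$ such that every vertex of $V(G)\setminus S$ is adjacent to at least two vertices of $S$. For $s\ge 2$, $t\ge 0$, the subdivided star $S_s(K_{1,s+t})$ is the graph on $2s+t+1$ vertices obtained from the star $K_{1,s+t}$ by subdividing exactly $s$ of its edges once each; its center is the center of the star. -}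

module Defs where

open import Data.Nat using (ℕ; zero; suc; _+_; _*_; _∸_; _≤_; _<_; _≤ᵇ_; _<ᵇ_; _≡ᵇ_; _⊔_; _⊓_)
open import Data.Nat.Properties using (≤-decTotalOrder)
open import Data.Bool using (Bool; true; false; _∧_; _∨_; not; if_then_else_)
open import Data.Bool.Properties using (∨-comm)
open import Data.Fin using (Fin; zero; suc; toℕ; splitAt; _↑ˡ_; _↑ʳ_)
open import Data.Fin.Subset using (Subset; ∣_∣)
open import Data.Vec using (Vec; []; _∷_; lookup)
open import Data.List using (List; []; _∷_; map; foldr; take; length; filterᵇ; allFin; upTo; concatMap; _++_; last)
open import Data.List.Membership.Propositional using (_∈_)
open import Data.List.Relation.Unary.Unique.Propositional using (Unique)
open import Data.Nat.ListAction using (sum)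
open import Data.Maybe using (Maybe; just; nothing)
open import Data.Sum using (_⊎_; inj₁; inj₂)
open import Data.Product using (_×_; _,_)
open import Relation.Binary.PropositionalEquality using (_≡_; refl; sym; trans; cong)
open import Relation.Nullary using (does)
import Data.Fin as F

record Graph : Set where
  field
    n      : ℕ
    adj    : Fin n → Fin n → Bool
    adj-sym    : ∀ u v → adj u v ≡ adj v u
    adj-irrefl : ∀ v → adj v v ≡ false
open Graph public

count : ∀ {A : Set} → (A → Bool) → List A → ℕ
count p xs = length (filterᵇ p xs)

deg : (G : Graph) → Fin (n G) → ℕ
deg G v = count (adj G v) (allFin (n G))

pairs : ∀ k → List (Fin k × Fin k)
pairs k = concatMap (λ u → map (λ v → (u , v)) (allFin k)) (allFin k)

m : Graph → ℕ
m G = count (λ { (u , v) → (toℕ u <ᵇ toℕ v) ∧ adj G u v }) (pairs (n G))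

n₁ : Graph → ℕ
n₁ G = count (λ v → deg G v ≡ᵇ 1) (allFin (n G))

f : Graph → ℕ
f G = n G + 3 * m G + n₁ G

open import Data.List.Sort.InsertionSort ≤-decTotalOrder using (sort)

degSeq : Graph → List ℕ
degSeq G = sort (map (deg G) (allFin (n G)))

annih : Graph → ℕ
annih G = foldr _⊔_ 0
  (filterᵇ (λ k → sum (take k (degSeq G)) ≤ᵇ m G) (upTo (suc (n G))))

allSubsets : ∀ k → List (Subset k)
allSubsets zero    = [] ∷ []
allSubsets (suc k) = map (true ∷_) (allSubsets k) ++ map (false ∷_) (allSubsets k)

is2Dominating : (G : Graph) → Subset (n G) → Bool
is2Dominating G S = foldr _∧_ true
  (map (λ v → lookup S v ∨ (2 ≤ᵇ count (λ u → lookup S u ∧ adj G v u) (allFin (n G))))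
       (allFin (n G)))

-- γ₂(G) = minimum cardinality of a 2-dominating set (V(G) itself is one, so n(G) is a bound)
γ₂ : Graph → ℕ
γ₂ G = foldr _⊓_ (n G) (map ∣_∣ (filterᵇ (is2Dominating G) (allSubsets (n G))))

data Reach (G : Graph) : Fin (n G) → Fin (n G) → Set where
  here  : ∀ {v} → Reach G v v
  there : ∀ {u w v} → adj G u w ≡ true → Reach G w v → Reach G u v

Connected : Graph → Set
Connected G = ∀ u v → Reach G u v

data Path (G : Graph) : List (Fin (n G)) → Set where
  p0 : Path G []
  p1 : ∀ {v} → Path G (v ∷ [])
  p2 : ∀ {u v vs} → adj G u v ≡ true → Path G (v ∷ vs) → Path G (u ∷ v ∷ vs)

record IsCycle (G : Graph) (C : List (Fin (n G))) : Set where
  field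
    length≥3 : 3 ≤ length C
    distinct : Unique C
    path     : Path G C
    closing  : ∀ {u v} → Data.List.head C ≡ just u → last C ≡ just v → adj G v u ≡ true

-- Subdivided star S_s(K_{1,s+t}) on Fin (suc (s + s + t)), centre = zero

data Kind (s t : ℕ) : Set where
  centre : Kind s t
  sub    : Fin s → Kind s t
  leafY  : Fin s → Kind s t
  leafZ  : Fin t → Kind s t

kind : ∀ s t → Fin (suc (s + s + t)) → Kind s t
kind s t zero = centre
kind s t (suc j) with splitAt (s + s) j
... | inj₂ b = leafZ b
... | inj₁ a with splitAt s a
...   | inj₁ i = sub i
...   | inj₂ i = leafY i

kadj : ∀ {s t} → Kind s t → Kind s t → Bool
kadj centre    (sub _)   = true
kadj (sub _)   centre    = true
kadj centre    (leafZ _) = true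
kadj (leafZ _) centre    = true
kadj (sub i)   (leafY j) = does (i F.≟ j)
kadj (leafY i) (sub j)   = does (i F.≟ j)
kadj _ _ = false

does-sym : ∀ {k} (i j : Fin k) → does (i F.≟ j) ≡ does (j F.≟ i)
does-sym i j with i F.≟ j | j F.≟ i
... | Relation.Nullary.yes _ | Relation.Nullary.yes _ = refl
... | Relation.Nullary.no _  | Relation.Nullary.no _  = refl
... | Relation.Nullary.yes p | Relation.Nullary.no q  = Data.Empty.⊥-elim (q (sym p))
  where import Data.Empty
... | Relation.Nullary.no p  | Relation.Nullary.yes q = Data.Empty.⊥-elim (p (sym q))
  where import Data.Empty

kadj-sym : ∀ {s t} (a b : Kind s t) → kadj a b ≡ kadj b a
kadj-sym centre centre = refl
kadj-sym centre (sub x) = refl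
kadj-sym centre (leafY x) = refl
kadj-sym centre (leafZ x) = refl
kadj-sym (sub x) centre = refl
kadj-sym (sub x) (sub x₁) = refl
kadj-sym (sub x) (leafY x₁) = does-sym x x₁
kadj-sym (sub x) (leafZ x₁) = refl
kadj-sym (leafY x) centre = refl
kadj-sym (leafY x) (sub x₁) = does-sym x x₁
kadj-sym (leafY x) (leafY x₁) = refl
kadj-sym (leafY x) (leafZ x₁) = refl
kadj-sym (leafZ x) centre = refl
kadj-sym (leafZ x) (sub x₁) = refl
kadj-sym (leafZ x) (leafY x₁) = refl
kadj-sym (leafZ x) (leafZ x₁) = refl

kadj-irrefl : ∀ {s t} (a : Kind s t) → kadj a a ≡ false
kadj-irrefl centre = refl
kadj-irrefl (sub x) = refl
kadj-irrefl (leafY x) = refl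
kadj-irrefl (leafZ x) = refl

SubdividedStar : (s t : ℕ) → Graph
SubdividedStar s t = record
  { n      = suc (s + s + t)
  ; adj    = λ u v → kadj (kind s t u) (kind s t v)
  ; adj-sym    = λ u v → kadj-sym (kind s t u) (kind s t v)
  ; adj-irrefl = λ v → kadj-irrefl (kind s t v)
  }

-- Gluing: identify vertex w of H with vertex zero of a graph S on Fin (suc k).
-- Vertices of the result: Fin (n H + k); the first n H are H's vertices,
-- vertex n H + j is S's vertex suc j.

liftAdj : ∀ {a} → (Fin a → Fin a → Bool) → Maybe (Fin a) → Maybe (Fin a) → Bool
liftAdj r (just x) (just y) = r x y
liftAdj r _        _        = false

liftAdj-sym : ∀ {a} (r : Fin a → Fin a → Bool) → (∀ x y → r x y ≡ r y x) →
              ∀ p q → liftAdj r p q ≡ liftAdj r q p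
liftAdj-sym r rs (just x) (just y) = rs x y
liftAdj-sym r rs (just x) nothing  = refl
liftAdj-sym r rs nothing  (just y) = refl
liftAdj-sym r rs nothing  nothing  = refl

liftAdj-irrefl : ∀ {a} (r : Fin a → Fin a → Bool) → (∀ x → r x x ≡ false) →
                 ∀ p → liftAdj r p p ≡ false
liftAdj-irrefl r ri (just x) = ri x
liftAdj-irrefl r ri nothing  = refl

module Glue {a k : ℕ} (w : Fin a) where

  toH : Fin (a + k) → Maybe (Fin a)
  toH g with splitAt a g
  ... | inj₁ v = just v
  ... | inj₂ _ = nothing

  toS : Fin (a + k) → Maybe (Fin (suc k))
  toS g with splitAt a g
  ... | inj₁ v = if does (v F.≟ w) then just zero else nothing
  ... | inj₂ j = just (suc j)

  glueAdj : (Fin a → Fin a → Bool) → (Fin (suc k) → Fin (suc k) → Bool) →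
            Fin (a + k) → Fin (a + k) → Bool
  glueAdj rH rS u v = liftAdj rH (toH u) (toH v) ∨ liftAdj rS (toS u) (toS v)

  glueAdj-sym : ∀ rH rS → (∀ x y → rH x y ≡ rH y x) → (∀ x y → rS x y ≡ rS y x) →
                ∀ u v → glueAdj rH rS u v ≡ glueAdj rH rS v u
  glueAdj-sym rH rS sH sS u v
    rewrite liftAdj-sym rH sH (toH u) (toH v) | liftAdj-sym rS sS (toS u) (toS v) = refl

  glueAdj-irrefl : ∀ rH rS → (∀ x → rH x x ≡ false) → (∀ x → rS x x ≡ false) →
                   ∀ v → glueAdj rH rS v v ≡ false
  glueAdj-irrefl rH rS iH iS v
    rewrite liftAdj-irrefl rH iH (toH v) | liftAdj-irrefl rS iS (toS v) = refl

glueStar : (H : Graph) → Fin (n H) → (s t : ℕ) → Graph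
glueStar H w s t = record
  { n      = n H + (s + s + t)
  ; adj    = glueAdj (adj H) (adj (SubdividedStar s t))
  ; adj-sym    = glueAdj-sym (adj H) (adj (SubdividedStar s t)) (adj-sym H) (adj-sym (SubdividedStar s t))
  ; adj-irrefl = glueAdj-irrefl (adj H) (adj (SubdividedStar s t)) (adj-irrefl H) (adj-irrefl (SubdividedStar s t))
  }
  where open Glue {n H} {s + s + t} w

module Submission where

-- Take G′ = H.  Passing from G to H lowers n and m and, w not being a leaf of H, creates no
-- leaves, so f(H) < f(G).  A 2-dominating set of H together with w and all leaves of the star
-- 2-dominates G (each subdivision vertex sees w and its own leaf), so γ₂(G) ≤ γ₂(H) + s + t + 1.
-- Since a(G) is the largest size of a vertex set whose degree sum is at most m(G), and
-- m(G) = m(H) + 2s + t, an annihilation set of H with w exchanged for a second subdivision vertex,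
-- together with one subdivision vertex and all leaves of the star, shows a(G) ≥ a(H) + s + t + 1.

open import Defs
open import Data.Nat
  using (ℕ; zero; suc; _≤_; _<_; _+_; _*_; _≡ᵇ_; _<ᵇ_; _≤ᵇ_; _⊔_; _⊓_; z≤n; s≤s; s≤s⁻¹; ⌊_/2⌋)
open import Data.Nat.Properties
open import Algebra.Properties.CommutativeMonoid.Sum +-0-commutativeMonoid
  using (sum; sum-syntax; sum-cong-≗; sum-replicate-zero; ∑-distrib-+; ∑-comm)
open import Algebra.Properties.CommutativeSemigroup +-commutativeSemigroup
  using (x∙yz≈y∙xz; xy∙z≈xz∙y; interchange)
open import Data.Bool using (Bool; true; false; _∧_; _∨_; not; if_then_else_; T?)
open import Data.Bool.Properties using (∧-zeroʳ; ∧-identityʳ; ∨-zeroʳ; ∨-identityʳ; T-≡)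
open import Data.Fin using (Fin; zero; suc; toℕ; splitAt; _↑ˡ_; _↑ʳ_)
import Data.Fin as Fin
import Data.Fin.Properties as Finₚ
open import Data.Fin.Subset using (Subset; ∣_∣)
open import Data.List as List
  using (List; []; _∷_; foldr; take; upTo; map; tabulate; allFin; concatMap; filterᵇ; length)
import Data.List.Properties as Listₚ
open import Data.List.Properties using (foldr-preservesᵒ)
open import Data.List.Membership.Propositional using (_∈_)
open import Data.List.Membership.Propositional.Properties
  using (∈-filter⁺; ∈-filter⁻; ∈-map⁺; ∈-map⁻; ∈-upTo⁺; ∈-upTo⁻; ∈-++⁺ˡ; ∈-++⁺ʳ; foldr-selective)
open import Data.List.Relation.Unary.Any as Any using (here)
open import Data.List.Relation.Unary.Linked using ([]; [-]; _∷_)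
open import Data.List.Relation.Unary.Sorted.TotalOrder ≤-totalOrder using (Sorted)
open import Data.List.Relation.Binary.Sublist.Propositional using (_⊆_; []; _∷_; _∷ʳ_)
open import Data.List.Relation.Binary.Sublist.Propositional.Properties using (length-mono-≤)
open import Data.List.Relation.Binary.Permutation.Propositional.Properties using (↭-length)
open import Data.List.Sort.InsertionSort ≤-decTotalOrder using (sort; insert)
open import Data.List.Sort.InsertionSort.Properties ≤-decTotalOrder using (sort-↗; sort-↭)
open import Data.Maybe using (just; nothing)
open import Data.Nat.ListAction using () renaming (sum to sumˡ)
open import Data.Nat.Tactic.RingSolver using (solve-∀)
open import Data.Product using (Σ; ∃; _×_; _,_; proj₂)
open import Data.Sum using (_⊎_; inj₁; inj₂; [_,_])
open import Data.Vec using ([]; _∷_; lookup)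
import Data.Vec as Vec
import Data.Vec.Properties as Vecₚ
open import Data.Vec.Functional using (_++_)
open import Data.Vec.Functional.Properties using (lookup-++ˡ; lookup-++ʳ)
open import Function using (_∘_; id; case_of_)
open import Function.Bundles using (Equivalence)
open import Relation.Binary.Definitions using (tri<; tri≈; tri>)
open import Relation.Binary.PropositionalEquality
  using (_≡_; _≢_; refl; sym; trans; cong; cong₂; subst; module ≡-Reasoning)
open import Relation.Nullary.Decidable using (does; yes; no; dec-true; dec-false)
open import Relation.Nullary.Negation using (contradiction)

χ : Bool → ℕ
χ b = if b then 1 else 0

χ-∨ : ∀ a b → χ (a ∨ b) ≤ χ a + χ b
χ-∨ true  b = s≤s z≤n
χ-∨ false b = ≤-refl

∑-zero : ∀ {n} {f : Fin n → ℕ} → (∀ i → f i ≡ 0) → sum f ≡ 0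
∑-zero {n} f≗0 = trans (sum-cong-≗ f≗0) (sum-replicate-zero n)

∑-single : ∀ {n} (f : Fin n → ℕ) j → (∀ i → i ≢ j → f i ≡ 0) → sum f ≡ f j
∑-single f zero    f≗0 = trans (cong (f zero +_) (∑-zero λ i → f≗0 (suc i) λ ())) (+-identityʳ _)
∑-single f (suc j) f≗0 =
  cong₂ _+_ (f≗0 zero λ ()) (∑-single (f ∘ suc) j λ i i≢j → f≗0 (suc i) (i≢j ∘ Finₚ.suc-injective))

∑-≟ : ∀ {n} (i : Fin n) c → ∑[ j < n ] (if does (j Fin.≟ i) then c else 0) ≡ c
∑-≟ i c = trans (∑-single _ i λ j j≢i → cong (λ b → if b then c else 0) (dec-false (j Fin.≟ i) j≢i))
                (cong (λ b → if b then c else 0) (dec-true (i Fin.≟ i) refl))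

∑-const : ∀ n c → ∑[ i < n ] c ≡ n * c
∑-const zero    c = refl
∑-const (suc n) c = cong (c +_) (∑-const n c)

∑-one : ∀ n → ∑[ i < n ] 1 ≡ n
∑-one n = trans (∑-const n 1) (*-identityʳ n)

∑-mono-≤ : ∀ {n} {f g : Fin n → ℕ} → (∀ i → f i ≤ g i) → sum f ≤ sum g
∑-mono-≤ {zero}  f≤g = z≤n
∑-mono-≤ {suc n} f≤g = +-mono-≤ (f≤g zero) (∑-mono-≤ (f≤g ∘ suc))

∑-↑ : ∀ m {n} (f : Fin (m + n) → ℕ) → sum f ≡ ∑[ i < m ] f (i ↑ˡ n) + ∑[ j < n ] f (m ↑ʳ j)
∑-↑ zero    f = refl
∑-↑ (suc m) f = trans (cong (f zero +_) (∑-↑ m (f ∘ suc))) (sym (+-assoc (f zero) _ _))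

∀-↑ : ∀ m {n} {P : Fin (m + n) → Set} → (∀ i → P (i ↑ˡ n)) → (∀ j → P (m ↑ʳ j)) → ∀ v → P v
∀-↑ m {n} {P} P↑ˡ P↑ʳ v with splitAt m {n} v in eq
... | inj₁ i = subst P (Finₚ.splitAt⁻¹-↑ˡ eq) (P↑ˡ i)
... | inj₂ j = subst P (Finₚ.splitAt⁻¹-↑ʳ eq) (P↑ʳ j)

m+m≡n+n⇒m≡n : ∀ {m n} → m + m ≡ n + n → m ≡ n
m+m≡n+n⇒m≡n {m} {n} eq = trans (n≡⌊n+n/2⌋ m) (trans (cong ⌊_/2⌋ eq) (sym (n≡⌊n+n/2⌋ n)))

count-tabulate : ∀ {A : Set} (p : A → Bool) {n} (g : Fin n → A) →
                 count p (tabulate g) ≡ ∑[ i < n ] χ (p (g i))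
count-tabulate p {zero}  g = refl
count-tabulate p {suc n} g with p (g zero)
... | true  = cong suc (count-tabulate p (g ∘ suc))
... | false = count-tabulate p (g ∘ suc)

count-allFin : ∀ {n} (p : Fin n → Bool) → count p (allFin n) ≡ ∑[ i < n ] χ (p i)
count-allFin p = count-tabulate p id

count-++ : ∀ {A : Set} (p : A → Bool) xs ys → count p (xs List.++ ys) ≡ count p xs + count p ys
count-++ p xs ys = trans (cong length (Listₚ.filter-++ _ xs ys)) (Listₚ.length-++ (filterᵇ p xs))

count-concatMap : ∀ {A B : Set} (p : B → Bool) (h : A → List B) {n} (g : Fin n → A) →
                  count p (concatMap h (tabulate g)) ≡ ∑[ i < n ] count p (h (g i))
count-concatMap p h {zero}  g = refl
count-concatMap p h {suc n} g =
  trans (count-++ p (h (g zero)) _) (cong (count p (h (g zero)) +_) (count-concatMap p h (g ∘ suc)))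

deg-∑ : ∀ G v → deg G v ≡ ∑[ u < n G ] χ (adj G v u)
deg-∑ G v = count-allFin (adj G v)

deg-≤-n : ∀ G v → deg G v ≤ n G
deg-≤-n G v =
  ≤-trans (Listₚ.length-filter (T? ∘ adj G v) (allFin (n G))) (≤-reflexive (Listₚ.length-tabulate id))

isLowerEdge : ∀ G → Fin (n G) × Fin (n G) → Bool
isLowerEdge G (u , v) = (toℕ u <ᵇ toℕ v) ∧ adj G u v

m-∑ : ∀ G → m G ≡ ∑[ u < n G ] ∑[ v < n G ] χ (isLowerEdge G (u , v))
m-∑ G = trans (count-concatMap (isLowerEdge G) (λ u → map (u ,_) (allFin (n G))) id) (sum-cong-≗ λ u →
  trans (cong (count (isLowerEdge G)) (Listₚ.map-tabulate id (u ,_))) (count-tabulate (isLowerEdge G) (u ,_)))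

χ-adj-split : ∀ G u v → χ (adj G u v) ≡ χ (isLowerEdge G (u , v)) + χ (isLowerEdge G (v , u))
χ-adj-split G u v with <-cmp (toℕ u) (toℕ v)
... | tri< u<v _ v≮u
  rewrite dec-true (toℕ u <? toℕ v) u<v | dec-false (toℕ v <? toℕ u) v≮u = sym (+-identityʳ _)
... | tri> u≮v _ v<u
  rewrite dec-false (toℕ u <? toℕ v) u≮v | dec-true (toℕ v <? toℕ u) v<u = cong χ (adj-sym G u v)
... | tri≈ u≮v u≡v _
  rewrite Finₚ.toℕ-injective u≡v | dec-false (toℕ v <? toℕ v) u≮v | adj-irrefl G v = refl

handshake : ∀ G → ∑[ v < n G ] deg G v ≡ m G + m G
handshake G = begin
  ∑[ u < N ] deg G u                                            ≡⟨ sum-cong-≗ (deg-∑ G) ⟩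
  ∑[ u < N ] ∑[ v < N ] χ (adj G u v)                           ≡⟨ sum-cong-≗ split ⟩
  ∑[ u < N ] (∑[ v < N ] lower u v + ∑[ v < N ] lower v u)
    ≡⟨ ∑-distrib-+ (λ u → ∑[ v < N ] lower u v) (λ u → ∑[ v < N ] lower v u) ⟩
  ∑[ u < N ] ∑[ v < N ] lower u v + ∑[ u < N ] ∑[ v < N ] lower v u
    ≡⟨ cong₂ _+_ (sym (m-∑ G)) (trans (∑-comm (λ u v → lower v u)) (sym (m-∑ G))) ⟩
  m G + m G                                                     ∎
  where
  open ≡-Reasoning
  N = n G
  lower : Fin N → Fin N → ℕ
  lower u v = χ (isLowerEdge G (u , v))
  split : ∀ u → ∑[ v < N ] χ (adj G u v) ≡ ∑[ v < N ] lower u v + ∑[ v < N ] lower v u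
  split u = trans (sum-cong-≗ (χ-adj-split G u)) (∑-distrib-+ (lower u) (λ v → lower v u))

-- Vertex sets as Boolean masks

card : ∀ {n} → (Fin n → Bool) → ℕ
card X = sum (χ ∘ X)

weight : ∀ {n} → (Fin n → Bool) → (Fin n → ℕ) → ℕ
weight X d = sum (λ i → if X i then d i else 0)

_∖｛_｝ : ∀ {n} → (Fin n → Bool) → Fin n → (Fin n → Bool)
(X ∖｛ w ｝) i = X i ∧ not (does (i Fin.≟ w))

_∪｛_｝ : ∀ {n} → (Fin n → Bool) → Fin n → (Fin n → Bool)
(X ∪｛ w ｝) i = X i ∨ does (i Fin.≟ w)

∖｛｝⇒≢ : ∀ {n} (X : Fin n → Bool) w {i} → (X ∖｛ w ｝) i ≡ true → i ≢ w
∖｛｝⇒≢ X w X∖w∋w refl with w Fin.≟ w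
... | yes _  = case trans (sym (∧-zeroʳ (X w))) X∖w∋w of λ ()
... | no w≢w = w≢w refl

weight-cong : ∀ {n} (X : Fin n → Bool) {d d′ : Fin n → ℕ} →
              (∀ i → X i ≡ true → d i ≡ d′ i) → weight X d ≡ weight X d′
weight-cong X d≗d′ = sum-cong-≗ λ i → on-X i (X i) refl
  where
  on-X : ∀ i b → X i ≡ b → (if b then _ else 0) ≡ (if b then _ else 0)
  on-X i true  Xi = d≗d′ i Xi
  on-X i false _  = refl

weight-∖｛｝ : ∀ {n} (X : Fin n → Bool) (d : Fin n → ℕ) w →
              weight X d ≡ weight (X ∖｛ w ｝) d + (if X w then d w else 0)
weight-∖｛｝ {n} X d w = begin
  weight X d                                    ≡⟨ sum-cong-≗ (λ i → split (X i) (does (i Fin.≟ w))) ⟩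
  ∑[ i < n ] (off-w i + at-w i)                 ≡⟨ ∑-distrib-+ off-w at-w ⟩
  weight (X ∖｛ w ｝) d + sum at-w                 ≡⟨ cong (weight (X ∖｛ w ｝) d +_) (∑-single at-w w at-w≗0) ⟩
  weight (X ∖｛ w ｝) d + at-w w                   ≡⟨ cong (weight (X ∖｛ w ｝) d +_) at-w-w ⟩
  weight (X ∖｛ w ｝) d + (if X w then d w else 0) ∎
  where
  open ≡-Reasoning
  off-w at-w : Fin n → ℕ
  off-w i = if (X ∖｛ w ｝) i then d i else 0
  at-w i = if X i ∧ does (i Fin.≟ w) then d i else 0
  split : ∀ {x} b c → (if b then x else 0) ≡ (if b ∧ not c then x else 0) + (if b ∧ c then x else 0)
  split true  true  = refl
  split true  false = sym (+-identityʳ _)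
  split false c     = refl
  at-w≗0 : ∀ i → i ≢ w → at-w i ≡ 0
  at-w≗0 i i≢w rewrite dec-false (i Fin.≟ w) i≢w | ∧-zeroʳ (X i) = refl
  at-w-w : at-w w ≡ (if X w then d w else 0)
  at-w-w rewrite dec-true (w Fin.≟ w) refl | ∧-identityʳ (X w) = refl

card-∖｛｝ : ∀ {n} (X : Fin n → Bool) w → card X ≡ card (X ∖｛ w ｝) + χ (X w)
card-∖｛｝ X = weight-∖｛｝ X (λ _ → 1)

card-∪｛｝ : ∀ {n} (X : Fin n → Bool) w → card (X ∪｛ w ｝) ≤ card X + 1
card-∪｛｝ {n} X w = begin
  card (X ∪｛ w ｝)                          ≤⟨ ∑-mono-≤ (λ i → χ-∨ (X i) (does (i Fin.≟ w))) ⟩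
  ∑[ i < n ] (χ (X i) + χ (does (i Fin.≟ w))) ≡⟨ ∑-distrib-+ (χ ∘ X) (λ i → χ (does (i Fin.≟ w))) ⟩
  card X + ∑[ i < n ] χ (does (i Fin.≟ w))  ≡⟨ cong (card X +_) (∑-≟ w 1) ⟩
  card X + 1                                ∎
  where open ≤-Reasoning

weight-++ : ∀ {a k} (X : Fin a → Bool) (Y : Fin k → Bool) (d : Fin (a + k) → ℕ) →
            weight (X ++ Y) d ≡ weight X (d ∘ (_↑ˡ k)) + weight Y (d ∘ (a ↑ʳ_))
weight-++ {a} X Y d = trans (∑-↑ a _) (cong₂ _+_
  (sum-cong-≗ λ i → cong (λ b → if b then d (i ↑ˡ _) else 0) (lookup-++ˡ X Y i))
  (sum-cong-≗ λ j → cong (λ b → if b then d (a ↑ʳ j) else 0) (lookup-++ʳ X Y j)))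

card-++ : ∀ {a k} (X : Fin a → Bool) (Y : Fin k → Bool) → card (X ++ Y) ≡ card X + card Y
card-++ X Y = weight-++ X Y (λ _ → 1)

-- Prefix sums of sorted lists

insert-≤ : ∀ {x y} ys → x ≤ y → insert x (y ∷ ys) ≡ x ∷ y ∷ ys
insert-≤ {x} {y} _ x≤y rewrite dec-true (x ≤? y) x≤y = refl

insert-> : ∀ {x y} ys → y < x → insert x (y ∷ ys) ≡ y ∷ insert x ys
insert-> {x} {y} _ y<x rewrite dec-false (x ≤? y) (<⇒≱ y<x) = refl

length-sort : ∀ xs → length (sort xs) ≡ length xs
length-sort xs = ↭-length (sort-↭ xs)

sum-take-cons-≤ : ∀ {y ys} k → Sorted (y ∷ ys) → k ≤ length ys →
                  sumˡ (take k (y ∷ ys)) ≤ sumˡ (take k ys)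
sum-take-cons-≤ zero    _              _        = z≤n
sum-take-cons-≤ (suc k) (y≤z ∷ sorted) (s≤s k≤) = +-mono-≤ y≤z (sum-take-cons-≤ k sorted k≤)

sum-take-insert-≤ : ∀ x {ys} k → Sorted ys → k ≤ length ys →
                    sumˡ (take k (insert x ys)) ≤ sumˡ (take k ys)
sum-take-insert-≤ x zero _ _ = z≤n
sum-take-insert-≤ x {y ∷ ys} (suc k) sorted (s≤s k≤) with x ≤? y
... | yes x≤y rewrite insert-≤ ys x≤y = +-mono-≤ x≤y (sum-take-cons-≤ k sorted k≤)
... | no  x≰y rewrite insert-> ys (≰⇒> x≰y) = +-monoʳ-≤ y (sum-take-insert-≤ x k (tail sorted) k≤)
  where
  tail : ∀ {y ys} → Sorted (y ∷ ys) → Sorted ys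
  tail [-]          = []
  tail (_ ∷ sorted) = sorted

sum-take-suc-insert-≤ : ∀ x ys k → sumˡ (take (suc k) (insert x ys)) ≤ x + sumˡ (take k ys)
sum-take-suc-insert-≤ x []       k = ≤-refl
sum-take-suc-insert-≤ x (y ∷ ys) k with x ≤? y
... | yes x≤y rewrite insert-≤ ys x≤y = ≤-refl
... | no  x≰y rewrite insert-> ys (≰⇒> x≰y) with k
...   | zero  = +-monoˡ-≤ 0 (<⇒≤ (≰⇒> x≰y))
...   | suc k = ≤-trans (+-monoʳ-≤ y (sum-take-suc-insert-≤ x ys k)) (≤-reflexive (x∙yz≈y∙xz y x _))

sum-take-insert : ∀ x ys k →
    (k ≤ length ys × sumˡ (take k (insert x ys)) ≡ sumˡ (take k ys))
  ⊎ ∃ λ k′ → k ≡ suc k′ × sumˡ (take k (insert x ys)) ≡ x + sumˡ (take k′ ys)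
sum-take-insert x ys       zero    = inj₁ (z≤n , refl)
sum-take-insert x []       (suc k) = inj₂ (k , refl , refl)
sum-take-insert x (y ∷ ys) (suc k) with x ≤? y
... | yes x≤y rewrite insert-≤ ys x≤y = inj₂ (k , refl , refl)
... | no  x≰y rewrite insert-> ys (≰⇒> x≰y) with sum-take-insert x ys k
...   | inj₁ (k≤ , eq)        = inj₁ (s≤s k≤ , cong (y +_) eq)
...   | inj₂ (k′ , refl , eq) = inj₂ (suc k′ , refl , trans (cong (y +_) eq) (x∙yz≈y∙xz y x _))

sum-take-sort-≤ : ∀ {zs xs} → zs ⊆ xs → sumˡ (take (length zs) (sort xs)) ≤ sumˡ zs
sum-take-sort-≤ [] = z≤n
sum-take-sort-≤ {zs} {y ∷ xs} (.y ∷ʳ zs⊆xs) = ≤-trans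
  (sum-take-insert-≤ y (length zs) (sort-↗ xs)
    (≤-trans (length-mono-≤ zs⊆xs) (≤-reflexive (sym (length-sort xs)))))
  (sum-take-sort-≤ zs⊆xs)
sum-take-sort-≤ {y ∷ zs} {.y ∷ xs} (refl ∷ zs⊆xs) =
  ≤-trans (sum-take-suc-insert-≤ y (sort xs) (length zs)) (+-monoʳ-≤ y (sum-take-sort-≤ zs⊆xs))

sum-take-sort-attained : ∀ xs {k} → k ≤ length xs →
  ∃ λ zs → zs ⊆ xs × length zs ≡ k × sumˡ zs ≤ sumˡ (take k (sort xs))
sum-take-sort-attained []       z≤n = [] , [] , refl , z≤n
sum-take-sort-attained (y ∷ xs) {k} k≤ with sum-take-insert y (sort xs) k
... | inj₁ (k≤′ , eq) with sum-take-sort-attained xs (subst (k ≤_) (length-sort xs) k≤′)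
...   | zs , zs⊆xs , len , sum≤ = zs , y ∷ʳ zs⊆xs , len , ≤-trans sum≤ (≤-reflexive (sym eq))
sum-take-sort-attained (y ∷ xs) k≤ | inj₂ (k′ , refl , eq) with sum-take-sort-attained xs (s≤s⁻¹ k≤)
...   | zs , zs⊆xs , len , sum≤ =
  y ∷ zs , refl ∷ zs⊆xs , cong suc len , ≤-trans (+-monoʳ-≤ y sum≤) (≤-reflexive (sym eq))

select : ∀ {n} → (Fin n → Bool) → (Fin n → ℕ) → List ℕ
select {zero}  X d = []
select {suc n} X d with X zero
... | true  = d zero ∷ select (X ∘ suc) (d ∘ suc)
... | false = select (X ∘ suc) (d ∘ suc)

select-⊆ : ∀ {n} (X : Fin n → Bool) d → select X d ⊆ tabulate d
select-⊆ {zero}  X d = []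
select-⊆ {suc n} X d with X zero
... | true  = refl ∷ select-⊆ (X ∘ suc) (d ∘ suc)
... | false = d zero ∷ʳ select-⊆ (X ∘ suc) (d ∘ suc)

length-select : ∀ {n} (X : Fin n → Bool) d → length (select X d) ≡ card X
length-select {zero}  X d = refl
length-select {suc n} X d with X zero
... | true  = cong suc (length-select (X ∘ suc) (d ∘ suc))
... | false = length-select (X ∘ suc) (d ∘ suc)

sum-select : ∀ {n} (X : Fin n → Bool) d → sumˡ (select X d) ≡ weight X d
sum-select {zero}  X d = refl
sum-select {suc n} X d with X zero
... | true  = cong (d zero +_) (sum-select (X ∘ suc) (d ∘ suc))
... | false = sum-select (X ∘ suc) (d ∘ suc)

⊆-tabulate⇒select : ∀ {n} (d : Fin n → ℕ) {zs} → zs ⊆ tabulate d → ∃ λ X → select X d ≡ zs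
⊆-tabulate⇒select {zero}  d [] = (λ ()) , refl
⊆-tabulate⇒select {suc n} d (_ ∷ʳ zs⊆) with X , eq ← ⊆-tabulate⇒select (d ∘ suc) zs⊆ =
  (λ { zero → false ; (suc i) → X i }) , eq
⊆-tabulate⇒select {suc n} d (refl ∷ zs⊆) with X , eq ← ⊆-tabulate⇒select (d ∘ suc) zs⊆ =
  (λ { zero → true ; (suc i) → X i }) , cong (d zero ∷_) eq

module _ {A : Set} (p : A → Bool) where

  ∈-filterᵇ⁺ : ∀ {x xs} → x ∈ xs → p x ≡ true → x ∈ filterᵇ p xs
  ∈-filterᵇ⁺ x∈xs px = ∈-filter⁺ (T? ∘ p) x∈xs (Equivalence.from T-≡ px)

  ∈-filterᵇ⁻ : ∀ {x} xs → x ∈ filterᵇ p xs → x ∈ xs × p x ≡ true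
  ∈-filterᵇ⁻ xs x∈ with x∈xs , px ← ∈-filter⁻ (T? ∘ p) {xs = xs} x∈ = x∈xs , Equivalence.to T-≡ px

  foldr-⊓-filter-≤ : ∀ (g : A → ℕ) c {x} xs → x ∈ xs → p x ≡ true →
                     foldr _⊓_ c (map g (filterᵇ p xs)) ≤ g x
  foldr-⊓-filter-≤ g c xs x∈xs px =
    foldr-preservesᵒ (λ a b → [ m≤n⇒m⊓o≤n b , m≤n⇒o⊓m≤n a ]) c (map g (filterᵇ p xs))
      (inj₂ (Any.map (≤-reflexive ∘ sym) (∈-map⁺ g (∈-filterᵇ⁺ x∈xs px))))

  foldr-⊓-filter-attained : ∀ (g : A → ℕ) c xs → let μ = foldr _⊓_ c (map g (filterᵇ p xs)) in
                            μ ≡ c ⊎ ∃ λ x → p x ≡ true × μ ≡ g x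
  foldr-⊓-filter-attained g c xs with foldr-selective ⊓-sel c (map g (filterᵇ p xs))
  ... | inj₁ μ≡c = inj₁ μ≡c
  ... | inj₂ μ∈  with x , x∈ , μ≡gx ← ∈-map⁻ g μ∈ = inj₂ (x , proj₂ (∈-filterᵇ⁻ xs x∈) , μ≡gx)

module _ (p : ℕ → Bool) where

  foldr-⊔-filter-≥ : ∀ {x} xs → x ∈ xs → p x ≡ true → x ≤ foldr _⊔_ 0 (filterᵇ p xs)
  foldr-⊔-filter-≥ xs x∈xs px =
    foldr-preservesᵒ (λ a b → [ m≤n⇒m≤n⊔o b , m≤n⇒m≤o⊔n a ]) 0 (filterᵇ p xs)
      (inj₂ (Any.map ≤-reflexive (∈-filterᵇ⁺ p x∈xs px)))

  foldr-⊔-filter-attained : ∀ xs → let μ = foldr _⊔_ 0 (filterᵇ p xs) in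
                            μ ≡ 0 ⊎ (μ ∈ xs × p μ ≡ true)
  foldr-⊔-filter-attained xs with foldr-selective ⊔-sel 0 (filterᵇ p xs)
  ... | inj₁ μ≡0 = inj₁ μ≡0
  ... | inj₂ μ∈  = inj₂ (∈-filterᵇ⁻ p xs μ∈)

degSeq-tabulate : ∀ G → degSeq G ≡ sort (tabulate (deg G))
degSeq-tabulate G = cong sort (Listₚ.map-tabulate id (deg G))

module _ (G : Graph) where

  private
    fits : ℕ → Bool
    fits k = sumˡ (take k (degSeq G)) ≤ᵇ m G

  annih-greatest : ∀ k → k ≤ n G → sumˡ (take k (degSeq G)) ≤ m G → k ≤ annih G
  annih-greatest k k≤n sum≤m =
    foldr-⊔-filter-≥ fits (upTo (suc (n G))) (∈-upTo⁺ (s≤s k≤n)) (Equivalence.to T-≡ (≤⇒≤ᵇ sum≤m))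

  annih-fits : annih G ≤ n G × sumˡ (take (annih G) (degSeq G)) ≤ m G
  annih-fits with foldr-⊔-filter-attained fits (upTo (suc (n G)))
  ... | inj₁ a≡0 rewrite a≡0 = z≤n , z≤n
  ... | inj₂ (a∈ , fits-a) = s≤s⁻¹ (∈-upTo⁻ a∈) , ≤ᵇ⇒≤ _ _ (Equivalence.from T-≡ fits-a)

  card-≤-annih : ∀ X → weight X (deg G) ≤ m G → card X ≤ annih G
  card-≤-annih X weight≤m =
    subst (_≤ annih G) (length-select X (deg G)) (annih-greatest (length zs) length≤n (begin
      sumˡ (take (length zs) (degSeq G))                ≡⟨ cong (sumˡ ∘ take (length zs)) (degSeq-tabulate G) ⟩
      sumˡ (take (length zs) (sort (tabulate (deg G)))) ≤⟨ sum-take-sort-≤ (select-⊆ X (deg G)) ⟩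
      sumˡ zs                                           ≡⟨ sum-select X (deg G) ⟩
      weight X (deg G)                                  ≤⟨ weight≤m ⟩
      m G                                               ∎))
    where
    open ≤-Reasoning
    zs = select X (deg G)
    length≤n : length zs ≤ n G
    length≤n = ≤-trans (length-mono-≤ (select-⊆ X (deg G))) (≤-reflexive (Listₚ.length-tabulate (deg G)))

  annih-attained : ∃ λ X → card X ≡ annih G × weight X (deg G) ≤ m G
  annih-attained
    with a≤n , sum≤m ← annih-fits
    with zs , zs⊆ , len , sum≤ ← sum-take-sort-attained (tabulate (deg G))
                                   (subst (annih G ≤_) (sym (Listₚ.length-tabulate (deg G))) a≤n)
    with X , X-zs ← ⊆-tabulate⇒select (deg G) zs⊆ =
    X , trans (sym (length-select X (deg G))) (trans (cong length X-zs) len) , (begin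
      weight X (deg G)                                ≡⟨ sym (sum-select X (deg G)) ⟩
      sumˡ (select X (deg G))                         ≡⟨ cong sumˡ X-zs ⟩
      sumˡ zs                                         ≤⟨ sum≤ ⟩
      sumˡ (take (annih G) (sort (tabulate (deg G)))) ≡⟨ cong (sumˡ ∘ take (annih G)) (sym (degSeq-tabulate G)) ⟩
      sumˡ (take (annih G) (degSeq G))                ≤⟨ sum≤m ⟩
      m G                                             ∎)
    where open ≤-Reasoning

-- 2-domination

neighbours : (G : Graph) → (Fin (n G) → Bool) → Fin (n G) → ℕ
neighbours G X v = ∑[ u < n G ] χ (X u ∧ adj G v u)

TwoDominating : (G : Graph) → (Fin (n G) → Bool) → Set
TwoDominating G X = ∀ v → X v ≡ true ⊎ 2 ≤ neighbours G X v

neighbours-mono : ∀ G {X X′} → (∀ u → X u ≡ true → X′ u ≡ true) →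
                  ∀ v → neighbours G X v ≤ neighbours G X′ v
neighbours-mono G {X} {X′} X⊆X′ v = ∑-mono-≤ λ u → χ-∧-mono (X u) (X′ u) (adj G v u) (X⊆X′ u)
  where
  χ-∧-mono : ∀ a a′ b → (a ≡ true → a′ ≡ true) → χ (a ∧ b) ≤ χ (a′ ∧ b)
  χ-∧-mono true  a′ b a⇒a′ rewrite a⇒a′ refl = ≤-refl
  χ-∧-mono false a′ b _    = z≤n

∈-allSubsets : ∀ {n} (S : Subset n) → S ∈ allSubsets n
∈-allSubsets []          = here refl
∈-allSubsets (true ∷ S)  = ∈-++⁺ˡ (∈-map⁺ (true ∷_) (∈-allSubsets S))
∈-allSubsets (false ∷ S) = ∈-++⁺ʳ (map (true ∷_) (allSubsets _)) (∈-map⁺ (false ∷_) (∈-allSubsets S))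

∣∣≡card : ∀ {n} (S : Subset n) → ∣ S ∣ ≡ card (lookup S)
∣∣≡card []          = refl
∣∣≡card (true ∷ S)  = cong suc (∣∣≡card S)
∣∣≡card (false ∷ S) = ∣∣≡card S

and-tabulate⁺ : ∀ {n} (P : Fin n → Bool) → (∀ v → P v ≡ true) → foldr _∧_ true (tabulate P) ≡ true
and-tabulate⁺ {zero}  P all = refl
and-tabulate⁺ {suc n} P all rewrite all zero = and-tabulate⁺ (P ∘ suc) (all ∘ suc)

and-tabulate⁻ : ∀ {n} (P : Fin n → Bool) → foldr _∧_ true (tabulate P) ≡ true → ∀ v → P v ≡ true
and-tabulate⁻ {suc n} P and≡true v with P zero in P₀
and-tabulate⁻ {suc n} P and≡true zero    | true = P₀
and-tabulate⁻ {suc n} P and≡true (suc v) | true = and-tabulate⁻ (P ∘ suc) and≡true v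

module _ (G : Graph) where

  private
    N = n G

    dominated : Subset N → Fin N → Bool
    dominated S v = lookup S v ∨ (2 ≤ᵇ count (λ u → lookup S u ∧ adj G v u) (allFin N))

    is2Dominating-tabulate : ∀ S → is2Dominating G S ≡ foldr _∧_ true (tabulate (dominated S))
    is2Dominating-tabulate S = cong (foldr _∧_ true) (Listₚ.map-tabulate id (dominated S))

    count-neighbours : ∀ S v → count (λ u → lookup S u ∧ adj G v u) (allFin N) ≡ neighbours G (lookup S) v
    count-neighbours S v = count-allFin (λ u → lookup S u ∧ adj G v u)

  TwoDominating-cong : ∀ {X Y} → (∀ v → X v ≡ Y v) → TwoDominating G X → TwoDominating G Y
  TwoDominating-cong X≗Y dom v with dom v
  ... | inj₁ Xv  = inj₁ (trans (sym (X≗Y v)) Xv)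
  ... | inj₂ two = inj₂ (subst (2 ≤_) (sum-cong-≗ λ u → cong (λ b → χ (b ∧ adj G v u)) (X≗Y u)) two)

  TwoDominating⇒is2Dominating : ∀ S → TwoDominating G (lookup S) → is2Dominating G S ≡ true
  TwoDominating⇒is2Dominating S dom =
    trans (is2Dominating-tabulate S) (and-tabulate⁺ (dominated S) dominated-all)
    where
    dominated-all : ∀ v → dominated S v ≡ true
    dominated-all v with dom v
    ... | inj₁ Sv rewrite Sv = refl
    ... | inj₂ two rewrite count-neighbours S v | Equivalence.to T-≡ (≤⇒≤ᵇ two) = ∨-zeroʳ (lookup S v)

  is2Dominating⇒TwoDominating : ∀ S → is2Dominating G S ≡ true → TwoDominating G (lookup S)
  is2Dominating⇒TwoDominating S is2dom v
    with dominated-v ← and-tabulate⁻ (dominated S) (trans (sym (is2Dominating-tabulate S)) is2dom) v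
    with lookup S v
  ... | true  = inj₁ refl
  ... | false = inj₂ (subst (2 ≤_) (count-neighbours S v) (≤ᵇ⇒≤ 2 _ (Equivalence.from T-≡ dominated-v)))

  γ₂-≤-card : ∀ X → TwoDominating G X → γ₂ G ≤ card X
  γ₂-≤-card X dom = begin
    γ₂ G            ≤⟨ foldr-⊓-filter-≤ (is2Dominating G) ∣_∣ N (allSubsets N) (∈-allSubsets S)
                         (TwoDominating⇒is2Dominating S (TwoDominating-cong (sym ∘ S≗X) dom)) ⟩
    ∣ S ∣           ≡⟨ ∣∣≡card S ⟩
    card (lookup S) ≡⟨ sum-cong-≗ (cong χ ∘ S≗X) ⟩
    card X          ∎
    where
    open ≤-Reasoning
    S = Vec.tabulate X
    S≗X = Vecₚ.lookup∘tabulate X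

  γ₂-attained : ∃ λ X → TwoDominating G X × card X ≤ γ₂ G
  γ₂-attained with foldr-⊓-filter-attained (is2Dominating G) ∣_∣ N (allSubsets N)
  ... | inj₁ γ₂≡N = (λ _ → true) , (λ _ → inj₁ refl) , ≤-reflexive (trans (∑-one N) (sym γ₂≡N))
  ... | inj₂ (S , is2dom , γ₂≡∣S∣) =
    lookup S , is2Dominating⇒TwoDominating S is2dom , ≤-reflexive (trans (sym (∣∣≡card S)) (sym γ₂≡∣S∣))

-- Gluing two graphs at a vertex

module Gluing (H : Graph) (w : Fin (n H)) (k : ℕ)
              (adjS : Fin (suc k) → Fin (suc k) → Bool)
              (adjS-sym : ∀ u v → adjS u v ≡ adjS v u)
              (adjS-irrefl : ∀ v → adjS v v ≡ false) where

  open Glue {n H} {k} w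

  S : Graph
  S = record { n = suc k ; adj = adjS ; adj-sym = adjS-sym ; adj-irrefl = adjS-irrefl }

  G : Graph
  G = record
    { n          = n H + k
    ; adj        = glueAdj (adj H) adjS
    ; adj-sym    = glueAdj-sym (adj H) adjS (adj-sym H) adjS-sym
    ; adj-irrefl = glueAdj-irrefl (adj H) adjS (adj-irrefl H) adjS-irrefl
    }

  inH : Fin (n H) → Fin (n G)
  inH i = i ↑ˡ k

  -- the copy in G of the vertex suc j of S
  inS : Fin k → Fin (n G)
  inS j = n H ↑ʳ j

  private
    toH-inH : ∀ i → toH (inH i) ≡ just i
    toH-inH i rewrite Finₚ.splitAt-↑ˡ (n H) i k = refl

    toH-inS : ∀ j → toH (inS j) ≡ nothing
    toH-inS j rewrite Finₚ.splitAt-↑ʳ (n H) k j = refl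

    toS-inH : ∀ i → toS (inH i) ≡ (if does (i Fin.≟ w) then just zero else nothing)
    toS-inH i rewrite Finₚ.splitAt-↑ˡ (n H) i k = refl

    toS-inS : ∀ j → toS (inS j) ≡ just (suc j)
    toS-inS j rewrite Finₚ.splitAt-↑ʳ (n H) k j = refl

  adj-inH-inH : ∀ i j → adj G (inH i) (inH j) ≡ adj H i j
  adj-inH-inH i j rewrite toH-inH i | toH-inH j | toS-inH i | toS-inH j
    with does (i Fin.≟ w) | does (j Fin.≟ w)
  ... | true  | true  = trans (cong (adj H i j ∨_) (adjS-irrefl zero)) (∨-identityʳ _)
  ... | true  | false = ∨-identityʳ _
  ... | false | _     = ∨-identityʳ _

  adj-inH-inS : ∀ i j → adj G (inH i) (inS j) ≡ does (i Fin.≟ w) ∧ adjS zero (suc j)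
  adj-inH-inS i j rewrite toH-inH i | toH-inS j | toS-inH i | toS-inS j with does (i Fin.≟ w)
  ... | true  = refl
  ... | false = refl

  adj-inS-inH : ∀ i j → adj G (inS j) (inH i) ≡ does (i Fin.≟ w) ∧ adjS (suc j) zero
  adj-inS-inH i j =
    trans (adj-sym G _ _) (trans (adj-inH-inS i j) (cong (does (i Fin.≟ w) ∧_) (adjS-sym zero (suc j))))

  adj-inS-inS : ∀ j j′ → adj G (inS j) (inS j′) ≡ adjS (suc j) (suc j′)
  adj-inS-inS j j′ rewrite toH-inS j | toS-inS j | toS-inS j′ = refl

  ∑-glued : ∀ (f : Fin (n G) → ℕ) → sum f ≡ ∑[ i < n H ] f (inH i) + ∑[ j < k ] f (inS j)
  ∑-glued = ∑-↑ (n H)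

  ∑-inH-adj-inS : ∀ (c : Fin (n H) → Bool) j → c w ≡ true →
                  ∑[ i < n H ] χ (c i ∧ adj G (inS j) (inH i)) ≡ χ (adjS (suc j) zero)
  ∑-inH-adj-inS c j cw = trans (∑-single _ w off-w) (cong χ (begin
    c w ∧ adj G (inS j) (inH w)                   ≡⟨ cong₂ _∧_ cw (adj-inS-inH w j) ⟩
    true ∧ (does (w Fin.≟ w) ∧ adjS (suc j) zero) ≡⟨ cong (_∧ adjS (suc j) zero) (dec-true (w Fin.≟ w) refl) ⟩
    adjS (suc j) zero                             ∎))
    where
    open ≡-Reasoning
    off-w : ∀ i → i ≢ w → χ (c i ∧ adj G (inS j) (inH i)) ≡ 0
    off-w i i≢w rewrite adj-inS-inH i j | dec-false (i Fin.≟ w) i≢w | ∧-zeroʳ (c i) = refl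

  deg-inH : ∀ i → deg G (inH i) ≡ deg H i + (if does (i Fin.≟ w) then deg S zero else 0)
  deg-inH i = begin
    deg G (inH i)                                                     ≡⟨ trans (deg-∑ G (inH i)) (∑-glued _) ⟩
    ∑[ i′ < n H ] χ (adj G (inH i) (inH i′)) + ∑[ j < k ] χ (adj G (inH i) (inS j))
      ≡⟨ cong₂ _+_ (trans (sum-cong-≗ (cong χ ∘ adj-inH-inH i)) (sym (deg-∑ H i)))
                   (sum-cong-≗ (cong χ ∘ adj-inH-inS i)) ⟩
    deg H i + ∑[ j < k ] χ (does (i Fin.≟ w) ∧ adjS zero (suc j))     ≡⟨ cong (deg H i +_) (to-S (does (i Fin.≟ w))) ⟩
    deg H i + (if does (i Fin.≟ w) then deg S zero else 0)            ∎
    where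
    open ≡-Reasoning
    to-S : ∀ b → ∑[ j < k ] χ (b ∧ adjS zero (suc j)) ≡ (if b then deg S zero else 0)
    to-S true  = trans (cong (_+ ∑[ j < k ] χ (adjS zero (suc j))) (cong χ (sym (adjS-irrefl zero))))
                       (sym (deg-∑ S zero))
    to-S false = sum-replicate-zero k

  deg-inS : ∀ j → deg G (inS j) ≡ deg S (suc j)
  deg-inS j = begin
    deg G (inS j)                                                  ≡⟨ trans (deg-∑ G (inS j)) (∑-glued _) ⟩
    ∑[ i < n H ] χ (true ∧ adj G (inS j) (inH i)) + ∑[ j′ < k ] χ (adj G (inS j) (inS j′))
      ≡⟨ cong₂ _+_ (∑-inH-adj-inS (λ _ → true) j refl) (sum-cong-≗ (cong χ ∘ adj-inS-inS j)) ⟩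
    χ (adjS (suc j) zero) + ∑[ j′ < k ] χ (adjS (suc j) (suc j′)) ≡⟨ sym (deg-∑ S (suc j)) ⟩
    deg S (suc j)                                                  ∎
    where open ≡-Reasoning

  m-glued : m G ≡ m H + m S
  m-glued = m+m≡n+n⇒m≡n (begin
    m G + m G                                                    ≡⟨ sym (handshake G) ⟩
    ∑[ v < n G ] deg G v                                         ≡⟨ ∑-glued (deg G) ⟩
    ∑[ i < n H ] deg G (inH i) + ∑[ j < k ] deg G (inS j)
      ≡⟨ cong₂ _+_ (sum-cong-≗ deg-inH) (sum-cong-≗ deg-inS) ⟩
    ∑[ i < n H ] (deg H i + at-w i) + ∑[ j < k ] deg S (suc j)
      ≡⟨ cong (_+ ∑[ j < k ] deg S (suc j)) (trans (∑-distrib-+ (deg H) at-w)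
                                                   (cong (∑[ i < n H ] deg H i +_) (∑-≟ w (deg S zero)))) ⟩
    ∑[ i < n H ] deg H i + deg S zero + ∑[ j < k ] deg S (suc j)
      ≡⟨ +-assoc (∑[ i < n H ] deg H i) (deg S zero) _ ⟩
    ∑[ i < n H ] deg H i + ∑[ v < suc k ] deg S v                ≡⟨ cong₂ _+_ (handshake H) (handshake S) ⟩
    (m H + m H) + (m S + m S)                                    ≡⟨ interchange (m H) (m H) (m S) (m S) ⟩
    (m H + m S) + (m H + m S)                                    ∎)
    where
    open ≡-Reasoning
    at-w : Fin (n H) → ℕ
    at-w i = if does (i Fin.≟ w) then deg S zero else 0

  n₁-glued-≥ : deg H w ≢ 1 → n₁ H ≤ n₁ G
  n₁-glued-≥ degw≢1 = begin
    n₁ H                                ≡⟨ count-allFin (λ i → deg H i ≡ᵇ 1) ⟩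
    ∑[ i < n H ] χ (deg H i ≡ᵇ 1)       ≤⟨ ∑-mono-≤ leaf-stays-leaf ⟩
    ∑[ i < n H ] χ (deg G (inH i) ≡ᵇ 1) ≤⟨ m≤m+n _ _ ⟩
    ∑[ i < n H ] χ (deg G (inH i) ≡ᵇ 1) + ∑[ j < k ] χ (deg G (inS j) ≡ᵇ 1)
                                        ≡⟨ sym (∑-glued (λ v → χ (deg G v ≡ᵇ 1))) ⟩
    ∑[ v < n G ] χ (deg G v ≡ᵇ 1)       ≡⟨ sym (count-allFin (λ v → deg G v ≡ᵇ 1)) ⟩
    n₁ G                                ∎
    where
    open ≤-Reasoning
    leaf-stays-leaf : ∀ i → χ (deg H i ≡ᵇ 1) ≤ χ (deg G (inH i) ≡ᵇ 1)
    leaf-stays-leaf i with i Fin.≟ w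
    ... | no i≢w rewrite deg-inH i | dec-false (i Fin.≟ w) i≢w | +-identityʳ (deg H i) = ≤-refl
    ... | yes refl with deg H i ≡ᵇ 1 in isLeaf
    ...   | true  = contradiction (≡ᵇ⇒≡ (deg H i) 1 (Equivalence.from T-≡ isLeaf)) degw≢1
    ...   | false = z≤n

  f-glued-> : 0 < k → deg H w ≢ 1 → f H < f G
  f-glued-> 0<k degw≢1 =
    +-mono-<-≤ (+-mono-<-≤ (m<m+n (n H) 0<k) (*-monoʳ-≤ 3 mH≤mG)) (n₁-glued-≥ degw≢1)
    where
    mH≤mG : m H ≤ m G
    mH≤mG = ≤-trans (m≤m+n (m H) (m S)) (≤-reflexive (sym m-glued))

  neighbours-inH-≥ : ∀ X Y i → neighbours H X i ≤ neighbours G (X ++ Y) (inH i)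
  neighbours-inH-≥ X Y i = begin
    neighbours H X i
      ≡⟨ sum-cong-≗ (λ i′ → cong₂ (λ b c → χ (b ∧ c)) (sym (lookup-++ˡ X Y i′)) (sym (adj-inH-inH i i′))) ⟩
    ∑[ i′ < n H ] χ ((X ++ Y) (inH i′) ∧ adj G (inH i) (inH i′))
      ≤⟨ m≤m+n _ _ ⟩
    ∑[ i′ < n H ] χ ((X ++ Y) (inH i′) ∧ adj G (inH i) (inH i′))
      + ∑[ j < k ] χ ((X ++ Y) (inS j) ∧ adj G (inH i) (inS j))
      ≡⟨ sym (∑-glued (λ u → χ ((X ++ Y) u ∧ adj G (inH i) u))) ⟩
    neighbours G (X ++ Y) (inH i)
      ∎
    where open ≤-Reasoning

  neighbours-inS : ∀ X T j → X w ≡ true → T zero ≡ true →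
                   neighbours G (X ++ (T ∘ suc)) (inS j) ≡ neighbours S T (suc j)
  neighbours-inS X T j Xw T₀ = begin
    neighbours G (X ++ (T ∘ suc)) (inS j)
      ≡⟨ ∑-glued _ ⟩
    ∑[ i < n H ] χ ((X ++ (T ∘ suc)) (inH i) ∧ adj G (inS j) (inH i))
      + ∑[ j′ < k ] χ ((X ++ (T ∘ suc)) (inS j′) ∧ adj G (inS j) (inS j′))
      ≡⟨ cong₂ _+_ (∑-inH-adj-inS _ j (trans (lookup-++ˡ X (T ∘ suc) w) Xw))
                   (sum-cong-≗ λ j′ → cong₂ (λ b c → χ (b ∧ c)) (lookup-++ʳ X (T ∘ suc) j′) (adj-inS-inS j j′)) ⟩
    χ (adjS (suc j) zero) + ∑[ j′ < k ] χ (T (suc j′) ∧ adjS (suc j) (suc j′))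
      ≡⟨ cong (λ b → χ (b ∧ adjS (suc j) zero) + ∑[ j′ < k ] χ (T (suc j′) ∧ adjS (suc j) (suc j′))) (sym T₀) ⟩
    neighbours S T (suc j)
      ∎
    where open ≡-Reasoning

  γ₂-glued-≤ : ∀ D T → TwoDominating H D → TwoDominating S T → T zero ≡ true →
               γ₂ G ≤ card D + card T
  γ₂-glued-≤ D T D-dom T-dom T₀ = begin
    γ₂ G                             ≤⟨ γ₂-≤-card G X X-dom ⟩
    card X                           ≡⟨ card-++ (D ∪｛ w ｝) (T ∘ suc) ⟩
    card (D ∪｛ w ｝) + card (T ∘ suc) ≤⟨ +-monoˡ-≤ (card (T ∘ suc)) (card-∪｛｝ D w) ⟩
    card D + 1 + card (T ∘ suc)      ≡⟨ +-assoc (card D) 1 (card (T ∘ suc)) ⟩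
    card D + (1 + card (T ∘ suc))    ≡⟨ cong (λ b → card D + (χ b + card (T ∘ suc))) (sym T₀) ⟩
    card D + card T                  ∎
    where
    open ≤-Reasoning
    X = (D ∪｛ w ｝) ++ (T ∘ suc)
    D∪w∋w : (D ∪｛ w ｝) w ≡ true
    D∪w∋w = trans (cong (D w ∨_) (dec-true (w Fin.≟ w) refl)) (∨-zeroʳ (D w))
    D⊆D∪w : ∀ i → D i ≡ true → (D ∪｛ w ｝) i ≡ true
    D⊆D∪w i Di = cong (_∨ does (i Fin.≟ w)) Di
    from-H : ∀ i → X (inH i) ≡ true ⊎ 2 ≤ neighbours G X (inH i)
    from-H i with D-dom i
    ... | inj₁ Di  = inj₁ (trans (lookup-++ˡ (D ∪｛ w ｝) (T ∘ suc) i) (D⊆D∪w i Di))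
    ... | inj₂ two = inj₂ (≤-trans two (≤-trans (neighbours-mono H D⊆D∪w i)
                                                (neighbours-inH-≥ (D ∪｛ w ｝) (T ∘ suc) i)))
    from-S : ∀ j → X (inS j) ≡ true ⊎ 2 ≤ neighbours G X (inS j)
    from-S j with T-dom (suc j)
    ... | inj₁ Tj  = inj₁ (trans (lookup-++ʳ (D ∪｛ w ｝) (T ∘ suc) j) Tj)
    ... | inj₂ two = inj₂ (subst (2 ≤_) (sym (neighbours-inS (D ∪｛ w ｝) T j D∪w∋w T₀)) two)
    X-dom : TwoDominating G X
    X-dom = ∀-↑ (n H) {P = λ v → X v ≡ true ⊎ 2 ≤ neighbours G X v} from-H from-S

  annih-glued-≥ : ∀ X Y → weight X (deg H) ≤ m H →
                  weight Y (deg S ∘ suc) ≤ (if X w then deg H w else 0) + m S →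
                  card (X ∖｛ w ｝) + card Y ≤ annih G
  annih-glued-≥ X Y X-fits Y-fits =
    subst (_≤ annih G) (card-++ (X ∖｛ w ｝) Y) (card-≤-annih G ((X ∖｛ w ｝) ++ Y) (begin
      weight ((X ∖｛ w ｝) ++ Y) (deg G)                            ≡⟨ weight-++ (X ∖｛ w ｝) Y (deg G) ⟩
      weight (X ∖｛ w ｝) (deg G ∘ inH) + weight Y (deg G ∘ inS)
        ≡⟨ cong₂ _+_ (weight-cong (X ∖｛ w ｝) deg-off-w) (weight-cong Y (λ j _ → deg-inS j)) ⟩
      weight (X ∖｛ w ｝) (deg H) + weight Y (deg S ∘ suc)          ≤⟨ +-monoʳ-≤ (weight (X ∖｛ w ｝) (deg H)) Y-fits ⟩
      weight (X ∖｛ w ｝) (deg H) + (at-w + m S)                    ≡⟨ sym (+-assoc _ at-w (m S)) ⟩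
      weight (X ∖｛ w ｝) (deg H) + at-w + m S                      ≡⟨ cong (_+ m S) (sym (weight-∖｛｝ X (deg H) w)) ⟩
      weight X (deg H) + m S                                      ≤⟨ +-monoˡ-≤ (m S) X-fits ⟩
      m H + m S                                                   ≡⟨ sym m-glued ⟩
      m G                                                         ∎))
    where
    open ≤-Reasoning
    at-w = if X w then deg H w else 0
    deg-off-w : ∀ i → (X ∖｛ w ｝) i ≡ true → deg G (inH i) ≡ deg H i
    deg-off-w i i∈X∖w rewrite deg-inH i | dec-false (i Fin.≟ w) (∖｛｝⇒≢ X w i∈X∖w) = +-identityʳ (deg H i)

-- The subdivided star

module SubdividedStarProperties (s t : ℕ) where

  Star : Graph
  Star = SubdividedStar s t

  kind-sub : ∀ i → kind s t (suc ((i ↑ˡ s) ↑ˡ t)) ≡ sub i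
  kind-sub i rewrite Finₚ.splitAt-↑ˡ (s + s) (i ↑ˡ s) t | Finₚ.splitAt-↑ˡ s i s = refl

  kind-leafY : ∀ i → kind s t (suc ((s ↑ʳ i) ↑ˡ t)) ≡ leafY i
  kind-leafY i rewrite Finₚ.splitAt-↑ˡ (s + s) (s ↑ʳ i) t | Finₚ.splitAt-↑ʳ s s i = refl

  kind-leafZ : ∀ j → kind s t (suc ((s + s) ↑ʳ j)) ≡ leafZ j
  kind-leafZ j rewrite Finₚ.splitAt-↑ʳ (s + s) t j = refl

  ∑-kind : ∀ (F : Kind s t → ℕ) → ∑[ j < s + s + t ] F (kind s t (suc j))
                                 ≡ ∑[ i < s ] F (sub i) + ∑[ i < s ] F (leafY i) + ∑[ j < t ] F (leafZ j)
  ∑-kind F = trans (∑-↑ (s + s) _) (cong₂ _+_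
    (trans (∑-↑ s _) (cong₂ _+_ (sum-cong-≗ (cong F ∘ kind-sub)) (sum-cong-≗ (cong F ∘ kind-leafY))))
    (sum-cong-≗ (cong F ∘ kind-leafZ)))

  ∑-sub-≟ : ∀ (i : Fin s) → ∑[ j < s ] χ (does (i Fin.≟ j)) ≡ 1
  ∑-sub-≟ i = trans (sum-cong-≗ (cong χ ∘ does-sym i)) (∑-≟ i 1)

  degreeOfKind : Kind s t → ℕ
  degreeOfKind centre    = s + t
  degreeOfKind (sub _)   = 2
  degreeOfKind (leafY _) = 1
  degreeOfKind (leafZ _) = 1

  deg-Star : ∀ v → deg Star v ≡ degreeOfKind (kind s t v)
  deg-Star v = trans (deg-∑ Star v) (trans (cong (χ (kadj κ centre) +_) (∑-kind (χ ∘ kadj κ))) (by-kind κ))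
    where
    κ = kind s t v
    by-kind : ∀ κ → χ (kadj κ centre) + (∑[ i < s ] χ (kadj κ (sub i)) + ∑[ i < s ] χ (kadj κ (leafY i))
                                         + ∑[ j < t ] χ (kadj κ (leafZ j)))
                    ≡ degreeOfKind κ
    by-kind centre    = cong₂ _+_ (trans (cong₂ _+_ (∑-one s) (sum-replicate-zero s)) (+-identityʳ s)) (∑-one t)
    by-kind (sub i)   = cong suc (cong₂ _+_ (cong₂ _+_ (sum-replicate-zero s) (∑-sub-≟ i)) (sum-replicate-zero t))
    by-kind (leafY i) = cong₂ _+_ (cong₂ _+_ (∑-sub-≟ i) (sum-replicate-zero s)) (sum-replicate-zero t)
    by-kind (leafZ j) =
      cong suc (cong₂ _+_ (cong₂ _+_ (sum-replicate-zero s) (sum-replicate-zero s)) (sum-replicate-zero t))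

  m-Star : m Star ≡ s + s + t
  m-Star = m+m≡n+n⇒m≡n (begin
    m Star + m Star                                                ≡⟨ sym (handshake Star) ⟩
    ∑[ v < suc (s + s + t) ] deg Star v                            ≡⟨ sum-cong-≗ deg-Star ⟩
    (s + t) + ∑[ j < s + s + t ] degreeOfKind (kind s t (suc j))   ≡⟨ cong ((s + t) +_) (∑-kind degreeOfKind) ⟩
    (s + t) + (∑[ i < s ] 2 + ∑[ i < s ] 1 + ∑[ j < t ] 1)
      ≡⟨ cong ((s + t) +_) (cong₂ _+_ (cong₂ _+_ (∑-const s 2) (∑-one s)) (∑-one t)) ⟩
    (s + t) + (s * 2 + s + t)                                      ≡⟨ arithmetic s t ⟩
    (s + s + t) + (s + s + t)                                      ∎)
    where
    open ≡-Reasoning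
    arithmetic : ∀ s t → (s + t) + (s * 2 + s + t) ≡ (s + s + t) + (s + s + t)
    arithmetic = solve-∀

  centreOrLeaf : Kind s t → Bool
  centreOrLeaf (sub _) = false
  centreOrLeaf _       = true

  centreAndLeaves : Fin (n Star) → Bool
  centreAndLeaves v = centreOrLeaf (kind s t v)

  card-centreAndLeaves : card centreAndLeaves ≡ suc (s + t)
  card-centreAndLeaves = cong suc (trans (∑-kind (χ ∘ centreOrLeaf))
    (cong₂ _+_ (trans (cong (_+ ∑[ i < s ] 1) (sum-replicate-zero s)) (∑-one s)) (∑-one t)))

  centreAndLeaves-2dom : TwoDominating Star centreAndLeaves
  centreAndLeaves-2dom v with kind s t v
  ... | centre  = inj₁ refl
  ... | leafY _ = inj₁ refl
  ... | leafZ _ = inj₁ refl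
  ... | sub i   = inj₂ (≤-reflexive (sym (cong suc (trans (∑-kind (λ κ → χ (centreOrLeaf κ ∧ kadj (sub i) κ)))
                      (cong₂ _+_ (cong₂ _+_ (sum-replicate-zero s) (∑-sub-≟ i)) (sum-replicate-zero t))))))

  -- The second subdivision vertex takes the place of w when w lies in the annihilation set of H.
  inLightSet : Bool → Kind s t → Bool
  inLightSet b (sub zero)          = true
  inLightSet b (sub (suc zero))    = b
  inLightSet b (sub (suc (suc _))) = false
  inLightSet b centre              = false
  inLightSet b (leafY _)           = true
  inLightSet b (leafZ _)           = true

  lightSet : Bool → Fin (s + s + t) → Bool
  lightSet b j = inLightSet b (kind s t (suc j))

  card-lightSet : 2 ≤ s → ∀ b → card (lightSet b) ≡ χ b + suc (s + t)
  card-lightSet (s≤s (s≤s {n = s′} _)) b = begin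
    card (lightSet b)                                        ≡⟨ ∑-kind (χ ∘ inLightSet b) ⟩
    suc (χ b + ∑[ i < s′ ] 0) + ∑[ i < s ] 1 + ∑[ j < t ] 1
      ≡⟨ cong₂ _+_ (cong₂ (λ x y → suc (χ b + x) + y) (sum-replicate-zero s′) (∑-one s)) (∑-one t) ⟩
    suc (χ b + 0) + s + t                                    ≡⟨ arithmetic (χ b) s t ⟩
    χ b + suc (s + t)                                        ∎
    where
    open ≡-Reasoning
    arithmetic : ∀ c s t → suc (c + 0) + s + t ≡ c + suc (s + t)
    arithmetic = solve-∀

  weight-lightSet : 2 ≤ s → ∀ b → weight (lightSet b) (deg Star ∘ suc) ≤ (if b then 2 else 0) + m Star
  weight-lightSet 2≤s@(s≤s (s≤s {n = s′} _)) b = begin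
    weight (lightSet b) (deg Star ∘ suc)
      ≡⟨ sum-cong-≗ (λ j → cong (λ d → if lightSet b j then d else 0) (deg-Star (suc j))) ⟩
    ∑[ j < s + s + t ] F (kind s t (suc j))               ≡⟨ ∑-kind F ⟩
    2 + (c + ∑[ i < s′ ] 0) + ∑[ i < s ] 1 + ∑[ j < t ] 1
      ≡⟨ cong₂ _+_ (cong₂ (λ x y → 2 + (c + x) + y) (sum-replicate-zero s′) (∑-one s)) (∑-one t) ⟩
    2 + (c + 0) + s + t                                   ≡⟨ arithmetic c s t ⟩
    c + (2 + s + t)                                       ≤⟨ +-monoʳ-≤ c (+-monoˡ-≤ t (+-monoˡ-≤ s 2≤s)) ⟩
    c + (s + s + t)                                       ≡⟨ cong (c +_) (sym m-Star) ⟩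
    c + m Star                                            ∎
    where
    open ≤-Reasoning
    c = if b then 2 else 0
    F : Kind s t → ℕ
    F κ = if inLightSet b κ then degreeOfKind κ else 0
    arithmetic : ∀ c s t → 2 + (c + 0) + s + t ≡ c + (2 + s + t)
    arithmetic = solve-∀

module GluedStar (H : Graph) (w : Fin (n H)) (s t : ℕ) where

  open SubdividedStarProperties s t public
  open Gluing H w (s + s + t) (adj Star) (adj-sym Star) (adj-irrefl Star) public

  f-glueStar-> : 2 ≤ s → deg H w ≡ 2 → f H < f G
  f-glueStar-> 2≤s degw≡2 = f-glued-> 0<k λ degw≡1 → case trans (sym degw≡2) degw≡1 of λ ()
    where
    0<k : 0 < s + s + t
    0<k = ≤-trans (≤-trans (s≤s z≤n) 2≤s) (≤-trans (m≤m+n s s) (m≤m+n (s + s) t))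

  γ₂-glueStar-≤ : γ₂ G ≤ γ₂ H + suc (s + t)
  γ₂-glueStar-≤ with D , D-dom , card-D≤γ₂ ← γ₂-attained H = begin
    γ₂ G                          ≤⟨ γ₂-glued-≤ D centreAndLeaves D-dom centreAndLeaves-2dom refl ⟩
    card D + card centreAndLeaves ≡⟨ cong (card D +_) card-centreAndLeaves ⟩
    card D + suc (s + t)          ≤⟨ +-monoˡ-≤ (suc (s + t)) card-D≤γ₂ ⟩
    γ₂ H + suc (s + t)            ∎
    where open ≤-Reasoning

  annih-glueStar-≥ : 2 ≤ s → deg H w ≡ 2 → annih H + suc (s + t) ≤ annih G
  annih-glueStar-≥ 2≤s degw≡2 with X , card-X≡a , X-fits ← annih-attained H = begin
    annih H + suc (s + t)                       ≡⟨ cong (_+ suc (s + t)) (sym card-X≡a) ⟩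
    card X + suc (s + t)                        ≡⟨ cong (_+ suc (s + t)) (card-∖｛｝ X w) ⟩
    card (X ∖｛ w ｝) + χ (X w) + suc (s + t)     ≡⟨ +-assoc (card (X ∖｛ w ｝)) (χ (X w)) (suc (s + t)) ⟩
    card (X ∖｛ w ｝) + (χ (X w) + suc (s + t))   ≡⟨ cong (card (X ∖｛ w ｝) +_) (sym (card-lightSet 2≤s (X w))) ⟩
    card (X ∖｛ w ｝) + card (lightSet (X w))     ≤⟨ annih-glued-≥ X (lightSet (X w)) X-fits light-fits ⟩
    annih G                                     ∎
    where
    open ≤-Reasoning
    light-fits : weight (lightSet (X w)) (deg Star ∘ suc) ≤ (if X w then deg H w else 0) + m Star
    light-fits rewrite degw≡2 = weight-lightSet 2≤s (X w)

lemma3p4 : (s t : ℕ) → 2 ≤ s →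
    (H : Graph) → Connected H →
    (C : List (Fin (n H))) → IsCycle H C →
    (w : Fin (n H)) → w ∈ C → deg H w ≡ 2 →
    Σ Graph (λ G′ →
      2 ≤ n G′ × Connected G′ × f G′ < f (glueStar H w s t) ×
      (γ₂ G′ ≤ annih G′ + 1 → γ₂ (glueStar H w s t) ≤ annih (glueStar H w s t) + 1))
lemma3p4 s t 2≤s H H-connected _ _ w _ degw≡2 =
  H , subst (_≤ n H) degw≡2 (deg-≤-n H w) , H-connected , f-glueStar-> 2≤s degw≡2 , transfer
  where
  open GluedStar H w s t
  transfer : γ₂ H ≤ annih H + 1 → γ₂ G ≤ annih G + 1
  transfer γ₂≤a+1 = begin
    γ₂ G                      ≤⟨ γ₂-glueStar-≤ ⟩
    γ₂ H + suc (s + t)        ≤⟨ +-monoˡ-≤ (suc (s + t)) γ₂≤a+1 ⟩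
    annih H + 1 + suc (s + t) ≡⟨ xy∙z≈xz∙y (annih H) 1 (suc (s + t)) ⟩
    annih H + suc (s + t) + 1 ≤⟨ +-monoˡ-≤ 1 (annih-glueStar-≥ 2≤s degw≡2) ⟩
    annih G + 1               ∎
    where open ≤-Reasoning
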